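{- Let $p(x,y,z)=ax^2+by^2+cz^2+dxy+exz+fyz$, where $a,b,c$ are non-zero integers and $d,e,f$ are integers, and suppose that $e^2-4ac$, $f^2-4bc$ and $(e+f)^2-4c(a+b+d)$ are non-zero squares. Then there exist admissible integers $\ell_0,\dots,\ell_4$ such that for every $k,m,n\in\mathbb{Z}$, the integers $x:=k\ell_0(m+\ell_1n)(m+\ell_2n)$ and $y:=k\ell_0(m+\ell_3n)(m+\ell_4n)$ satisfy $p(x,y,\lambda)=0$ for some $\lambda\in\mathbb{Z}$.
   Context: Integers $\ell_0,\dots,\ell_4$ are admissible if $\ell_0>0$, $\ell_1\neq\ell_2$, $\ell_3\neq\ell_4$, and $\{\ell_1,\ell_2\}\neq\{\ell_3,\ell_4\}$. -}

module Defs where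

open import Data.Integer using (ℤ; _+_; _*_; _-_; _>_; +_)
open import Data.Product using (Σ; _×_; _,_)
open import Data.Sum using (_⊎_)
open import Relation.Binary.PropositionalEquality using (_≡_; _≢_)
open import Relation.Nullary using (¬_)

quadForm : (a b c d e f x y z : ℤ) → ℤ
quadForm a b c d e f x y z =
  a * (x * x) + b * (y * y) + c * (z * z) + d * (x * y) + e * (x * z) + f * (y * z)

NonZeroSquare : ℤ → Set
NonZeroSquare n = (n ≢ + 0) × Σ ℤ (λ s → n ≡ s * s)

SameSet₂ : ℤ → ℤ → ℤ → ℤ → Set
SameSet₂ u v w t = ((u ≡ w) × (v ≡ t)) ⊎ ((u ≡ t) × (v ≡ w))

Admissible : ℤ → ℤ → ℤ → ℤ → ℤ → Set
Admissible l0 l1 l2 l3 l4 =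
  (l0 > + 0) × (l1 ≢ l2) × (l3 ≢ l4) × ¬ SameSet₂ l1 l2 l3 l4

module Submission where

-- Write D₁ = e²−4ac, D₂ = f²−4bc, D₃ = (e+f)²−4c(a+b+d) and
-- Q(X,Y) = D₁X² + (D₃−D₁−D₂)XY + D₂Y².  Completing the square in z gives
--   p(2ctX, 2ctY, t(W−eX−fY)) = c·t²·(W² − Q(X,Y)),
-- so every integer point of the conic W² = Q(X,Y) yields a zero of p.
-- When D₁ = s₁², D₂ = s₂², D₃ = s₃², the conic W² = s₁²X² + B·XY + s₂²Y²
-- (B = s₃²−s₁²−s₂²) has the rational point (1 : 0 : s₁) and hence an explicit
-- quadratic parametrisation by (M : m).  Choosing M = (s₃−s₁)m + uvn with
-- u = s₃−(s₁+s₂), v = s₃−(s₁−s₂), both coordinates of the parametrisation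
-- split into linear factors in (m,n), and scaling by N = 2cuv turns them into
--   x = k·N²·(m+vn)(m+un),   y = k·N²·(m+0·n)(m−2s₁n).
-- Admissibility of (N², v, u, 0, −2s₁) needs s₁, s₂, u, v ≠ 0; replacing s₃ by
-- −s₃ if necessary ensures u, v ≠ 0.
-- The file proves, in order: the completing-the-square identity, the conic
-- parametrisation, the factorisation, the resulting family of zeros of p,
-- the non-vanishing facts, and finally the proposition.

open import Defs
open import Data.Integer using (ℤ; _+_; _*_; _-_; +_)
open import Data.Product using (Σ; _×_; _,_)
open import Relation.Binary.PropositionalEquality using (_≡_; _≢_)

open import Data.Integer using (-_; +[1+_]; -[1+_]; _<_; +<+)
open import Data.Integer.Properties
  using (_≟_; i*j≡0⇒i≡0∨j≡0; i≡j⇒i-j≡0; i-j≡0⇒i≡j; *-zeroʳ)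
open import Data.Integer.Tactic.RingSolver using (solve-∀)
open import Data.Nat using (s≤s; z≤n)
open import Data.Sum using (inj₁; inj₂)
open import Relation.Nullary using (¬_; yes; no)
open import Relation.Binary.PropositionalEquality
  using (refl; sym; trans; cong; cong₂; module ≡-Reasoning)

binForm : (P S R X Y : ℤ) → ℤ
binForm P S R X Y = P * (X * X) + S * (X * Y) + R * (Y * Y)

-- Completing the square in z: p(2ctX, 2ctY, t(W−eX−fY)) = c·t²·(W² − Q(X,Y)),
-- where Q has the discriminants D₁, D₃−D₁−D₂, D₂ as coefficients.
-- (Stated with p and Q expanded, as the ring solver does not unfold definitions.)
completeSquare : ∀ a b c d e f t X Y W →
  let x = + 2 * c * t * X; y = + 2 * c * t * Y; z = t * (W - e * X - f * Y)
      D₁ = e * e - + 4 * a * c; D₂ = f * f - + 4 * b * c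
      D₃ = (e + f) * (e + f) - + 4 * c * (a + b + d)
  in a * (x * x) + b * (y * y) + c * (z * z) + d * (x * y) + e * (x * z) + f * (y * z)
     ≡ c * (t * t) * (W * W - (D₁ * (X * X) + (D₃ - D₁ - D₂) * (X * Y) + D₂ * (Y * Y)))
completeSquare = solve-∀

-- Coordinates (X, Y, W) of a point of the conic W² = s₁²X² + B·XY + s₂²Y²,
-- obtained from the line of slope (M : m) through its rational point (1 : 0 : s₁).
conicX : (s₂ M m : ℤ) → ℤ
conicX s₂ M m = M * M - s₂ * s₂ * (m * m)

conicY : (s₁ B M m : ℤ) → ℤ
conicY s₁ B M m = B * (m * m) - + 2 * s₁ * M * m

conicW : (s₁ s₂ B M m : ℤ) → ℤ
conicW s₁ s₂ B M m = - (s₁ * (M * M)) + B * M * m - s₁ * (s₂ * s₂) * (m * m)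

conicPoint : ∀ s₁ s₂ B M m →
  let X = M * M - s₂ * s₂ * (m * m); Y = B * (m * m) - + 2 * s₁ * M * m
      W = - (s₁ * (M * M)) + B * M * m - s₁ * (s₂ * s₂) * (m * m)
  in W * W ≡ s₁ * s₁ * (X * X) + B * (X * Y) + s₂ * s₂ * (Y * Y)
conicPoint = solve-∀

factorX : ∀ s₁ s₂ s₃ m n →
  let u = s₃ - (s₁ + s₂); v = s₃ - (s₁ - s₂); M = (s₃ - s₁) * m + u * v * n
  in u * v * ((m + v * n) * (m + u * n)) ≡ M * M - s₂ * s₂ * (m * m)
factorX = solve-∀

factorY : ∀ s₁ s₂ s₃ m n →
  let u = s₃ - (s₁ + s₂); v = s₃ - (s₁ - s₂); M = (s₃ - s₁) * m + u * v * n
      B = s₃ * s₃ - s₁ * s₁ - s₂ * s₂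
  in u * v * ((m + + 0 * n) * (m + (- + 2) * s₁ * n)) ≡ B * (m * m) - + 2 * s₁ * M * m
factorY = solve-∀

rescale : ∀ c u v k F → k * ((+ 2 * c * u * v) * (+ 2 * c * u * v)) * F
                        ≡ + 2 * c * (k * (+ 2 * c * u * v)) * (u * v * F)
rescale = solve-∀

squareDiscriminants : ∀ {D₁ D₂ D₃} s₁ s₂ s₃ X Y →
  D₁ ≡ s₁ * s₁ → D₂ ≡ s₂ * s₂ → D₃ ≡ s₃ * s₃ →
  binForm D₁ (D₃ - D₁ - D₂) D₂ X Y
    ≡ binForm (s₁ * s₁) (s₃ * s₃ - s₁ * s₁ - s₂ * s₂) (s₂ * s₂) X Y
squareDiscriminants s₁ s₂ s₃ X Y refl refl refl = refl

surfacePoints : ∀ a b c d e f s₁ s₂ s₃ →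
  e * e - + 4 * a * c ≡ s₁ * s₁ →
  f * f - + 4 * b * c ≡ s₂ * s₂ →
  (e + f) * (e + f) - + 4 * c * (a + b + d) ≡ s₃ * s₃ →
  let u = s₃ - (s₁ + s₂); v = s₃ - (s₁ - s₂); N = + 2 * c * u * v
  in (k m n : ℤ) → Σ ℤ λ z →
     quadForm a b c d e f (k * (N * N) * ((m + v * n) * (m + u * n)))
                          (k * (N * N) * ((m + + 0 * n) * (m + (- + 2) * s₁ * n))) z
       ≡ + 0
surfacePoints a b c d e f s₁ s₂ s₃ h₁ h₂ h₃ k m n = t * (W - e * X - f * Y) , (begin
    quadForm a b c d e f (k * (N * N) * Fx) (k * (N * N) * Fy) (t * (W - e * X - f * Y))
      ≡⟨ cong₂ (λ x y → quadForm a b c d e f x y (t * (W - e * X - f * Y)))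
               (trans (rescale c u v k Fx) (cong (+ 2 * c * t *_) (factorX s₁ s₂ s₃ m n)))
               (trans (rescale c u v k Fy) (cong (+ 2 * c * t *_) (factorY s₁ s₂ s₃ m n))) ⟩
    quadForm a b c d e f (+ 2 * c * t * X) (+ 2 * c * t * Y) (t * (W - e * X - f * Y))
      ≡⟨ completeSquare a b c d e f t X Y W ⟩
    c * (t * t) * (W * W - binForm D₁ (D₃ - D₁ - D₂) D₂ X Y)
      ≡⟨ cong (λ q → c * (t * t) * (W * W - q)) (squareDiscriminants s₁ s₂ s₃ X Y h₁ h₂ h₃) ⟩
    c * (t * t) * (W * W - binForm (s₁ * s₁) B (s₂ * s₂) X Y)
      ≡⟨ cong (c * (t * t) *_) (i≡j⇒i-j≡0 (conicPoint s₁ s₂ B M m)) ⟩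
    c * (t * t) * + 0
      ≡⟨ *-zeroʳ (c * (t * t)) ⟩
    + 0 ∎)
  where
    open ≡-Reasoning
    D₁ = e * e - + 4 * a * c
    D₂ = f * f - + 4 * b * c
    D₃ = (e + f) * (e + f) - + 4 * c * (a + b + d)
    u = s₃ - (s₁ + s₂)
    v = s₃ - (s₁ - s₂)
    N = + 2 * c * u * v
    t = k * N
    Fx = (m + v * n) * (m + u * n)
    Fy = (m + + 0 * n) * (m + (- + 2) * s₁ * n)
    B = s₃ * s₃ - s₁ * s₁ - s₂ * s₂
    M = (s₃ - s₁) * m + u * v * n
    X = conicX s₂ M m
    Y = conicY s₁ B M m
    W = conicW s₁ s₂ B M m

*-nonzero : ∀ {i j} → i ≢ + 0 → j ≢ + 0 → i * j ≢ + 0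
*-nonzero {i} i≢0 j≢0 ij≡0 with i*j≡0⇒i≡0∨j≡0 i ij≡0
... | inj₁ i≡0 = i≢0 i≡0
... | inj₂ j≡0 = j≢0 j≡0

square-positive : ∀ i → i ≢ + 0 → + 0 < i * i
square-positive (+ 0)     i≢0 with () ← i≢0 refl
square-positive +[1+ n ]  _   = +<+ (s≤s z≤n)
square-positive -[1+ n ]  _   = +<+ (s≤s z≤n)

root-nonzero : ∀ {D s} → D ≢ + 0 → D ≡ s * s → s ≢ + 0
root-nonzero D≢0 D≡s² refl = D≢0 D≡s²

apart : ∀ {x y z} → x - y ≡ z → z ≢ + 0 → x ≢ y
apart {x} {y} x-y≡z z≢0 x≡y = z≢0 (trans (sym x-y≡z) (i≡j⇒i-j≡0 x≡y))

difference-nonzero : ∀ {x y} → x ≢ y → x - y ≢ + 0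
difference-nonzero {x} {y} x≢y x-y≡0 = x≢y (i-j≡0⇒i≡j x y x-y≡0)

neg-square : ∀ r → (- r) * (- r) ≡ r * r
neg-square = solve-∀

neg-minus-self : ∀ r → - r - r ≡ (- + 2) * r
neg-minus-self = solve-∀

neg-sum-minus-diff : ∀ p q → - (p + q) - (p - q) ≡ (- + 2) * p
neg-sum-minus-diff = solve-∀

neg-diff-minus-sum : ∀ p q → - (p - q) - (p + q) ≡ (- + 2) * p
neg-diff-minus-sum = solve-∀

two-times-nonzero : ∀ {t} → t ≢ + 0 → + 2 * t ≢ + 0
two-times-nonzero = *-nonzero {+ 2} (λ ())

minus-two-times-nonzero : ∀ {t} → t ≢ + 0 → (- + 2) * t ≢ + 0
minus-two-times-nonzero = *-nonzero {i = - + 2} (λ ())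

-- Choice of sign for the root of D₃: one of ±s₃ avoids both s₁+s₂ and s₁−s₂
-- (if s₃ equals one of them, −s₃ differs from both by −2s₃ resp. −2s₁).
goodRoot : ∀ s₁ s₂ s₃ → s₁ ≢ + 0 → s₃ ≢ + 0 →
  Σ ℤ λ r → (r * r ≡ s₃ * s₃) × (r ≢ s₁ + s₂) × (r ≢ s₁ - s₂)
goodRoot s₁ s₂ s₃ s₁≢0 s₃≢0 with s₃ ≟ s₁ + s₂ | s₃ ≟ s₁ - s₂
... | yes refl | _ = - (s₁ + s₂) , neg-square (s₁ + s₂) ,
  apart (neg-minus-self (s₁ + s₂)) (minus-two-times-nonzero s₃≢0) ,
  apart (neg-sum-minus-diff s₁ s₂) (minus-two-times-nonzero s₁≢0)
... | no _ | yes refl = - (s₁ - s₂) , neg-square (s₁ - s₂) ,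
  apart (neg-diff-minus-sum s₁ s₂) (minus-two-times-nonzero s₁≢0) ,
  apart (neg-minus-self (s₁ - s₂)) (minus-two-times-nonzero s₃≢0)
... | no s₃≢s₁+s₂ | no s₃≢s₁-s₂ = s₃ , refl , s₃≢s₁+s₂ , s₃≢s₁-s₂

roots-difference : ∀ s₁ s₂ r → (r - (s₁ - s₂)) - (r - (s₁ + s₂)) ≡ + 2 * s₂
roots-difference = solve-∀

zero-minus-root : ∀ s₁ → + 0 - (- + 2) * s₁ ≡ + 2 * s₁
zero-minus-root = solve-∀

admissible : ∀ c s₁ s₂ r → c ≢ + 0 → s₁ ≢ + 0 → s₂ ≢ + 0 → r ≢ s₁ + s₂ → r ≢ s₁ - s₂ →
  let u = r - (s₁ + s₂); v = r - (s₁ - s₂); N = + 2 * c * u * v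
  in Admissible (N * N) v u (+ 0) ((- + 2) * s₁)
admissible c s₁ s₂ r c≢0 s₁≢0 s₂≢0 r≢s₁+s₂ r≢s₁-s₂ =
  square-positive N (*-nonzero (*-nonzero (two-times-nonzero c≢0) u≢0) v≢0) ,
  apart (roots-difference s₁ s₂ r) (two-times-nonzero s₂≢0) ,
  apart (zero-minus-root s₁) (two-times-nonzero s₁≢0) ,
  differentSets
  where
    u = r - (s₁ + s₂)
    v = r - (s₁ - s₂)
    N = + 2 * c * u * v
    u≢0 = difference-nonzero r≢s₁+s₂
    v≢0 = difference-nonzero r≢s₁-s₂
    differentSets : ¬ SameSet₂ v u (+ 0) ((- + 2) * s₁)
    differentSets (inj₁ (v≡0 , _)) = v≢0 v≡0
    differentSets (inj₂ (_ , u≡0)) = u≢0 u≡0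

-- Proposition 2.19: take a sign-adjusted root r of D₃ and use the family of
-- zeros above with ℓ = (N², v, u, 0, −2s₁).
proposition2p19 : (a b c d e f : ℤ) → a ≢ + 0 → b ≢ + 0 → c ≢ + 0 →
    NonZeroSquare (e * e - + 4 * a * c) →
    NonZeroSquare (f * f - + 4 * b * c) →
    NonZeroSquare ((e + f) * (e + f) - + 4 * c * (a + b + d)) →
    Σ ℤ λ l0 → Σ ℤ λ l1 → Σ ℤ λ l2 → Σ ℤ λ l3 → Σ ℤ λ l4 →
      Admissible l0 l1 l2 l3 l4 ×
      ((k m n : ℤ) → Σ ℤ λ λ' →
        quadForm a b c d e f
          (k * l0 * ((m + l1 * n) * (m + l2 * n)))
          (k * l0 * ((m + l3 * n) * (m + l4 * n)))
          λ' ≡ + 0)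
proposition2p19 a b c d e f _ _ c≢0 (D₁≢0 , s₁ , h₁) (D₂≢0 , s₂ , h₂) (D₃≢0 , s₃ , h₃)
  with goodRoot s₁ s₂ s₃ (root-nonzero D₁≢0 h₁) (root-nonzero D₃≢0 h₃)
... | r , r²≡s₃² , r≢s₁+s₂ , r≢s₁-s₂ =
  N * N , r - (s₁ - s₂) , r - (s₁ + s₂) , + 0 , (- + 2) * s₁ ,
  admissible c s₁ s₂ r c≢0 (root-nonzero D₁≢0 h₁) (root-nonzero D₂≢0 h₂) r≢s₁+s₂ r≢s₁-s₂ ,
  surfacePoints a b c d e f s₁ s₂ r h₁ h₂ (trans h₃ (sym r²≡s₃²))
  where
    N = + 2 * c * (r - (s₁ + s₂)) * (r - (s₁ - s₂))
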